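{- Let $\mathcal{M}$ be a deterministic labelled transition system with state space $S$ and transition function $T$. Suppose there exist a finite set $C$, a label-preserving state classifier $f\colon S\to C$, a function $g\colon C\to C$, and functions $h_c\colon S\to\mathbb{N}$ for each $c\in C$ such that for all $c\neq d\in C$ and all $s\in S$: (1) if $f(s)=c$ and $g(c)=d$, then $f(T(s))=d$ or [$f(T(s))=c$ and $h_c(s)>h_c(T(s))$]; (2) if $f(s)=c$ and $f(T(s))=d$, then $g(c)=d$. Then the relation $\simeq_f=\{(s,t)\mid f(s)=f(t)\}$ is a stutter-insensitive bisimulation on $\mathcal{M}$, and for every $c\in C$ with $f^{ -1}[c]\neq\emptyset$ the quotient transition function satisfies $T/_{\simeq_f}(f^{ -1}[c])=\{f^{ -1}[g(c)]\}$.
   Context: A transition system $\mathcal{M}$ consists of a state space $S$, an initial region $I \subseteq S$, and a transition function $T\colon S \to 2^S\setminus\{\emptyset\}$. It is deterministic if $|T(s)|=1$ for all $s\in S$; then $T(s)$ denotes the unique successor. It is labelled if it additionally has a set of atomic propositions $AP$ and a labelling function $\langle\!\langle\cdot\rangle\!\rangle\colon S\to 2^{AP}$. A state classifier is a function $f\colon S\to C$ into a finite set $C$; it is label-preserving if $f(s)=f(t)$ implies $\langle\!\langle s\rangle\!\rangle=\langle\!\langle t\rangle\!\rangle$. A trajectory is a sequence $s_0,s_1,\dots$ with $s_{i+1}\in T(s_i)$. For an equivalence relation $\simeq$ on $S$ with set of classes $S/_{\simeq}$: a state $s$ is $\simeq$-divergent if there is an infinite trajectory $s_0,s_1,\dots$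 with $s_0=s$ and $s_i\simeq s$ for all $i>0$; the quotient transition function $T/_{\simeq}$ on $S/_{\simeq}$ is defined by: for $R\neq Q$, $Q\in T/_{\simeq}(R)$ iff some $s\in R$ has a successor in $Q$; $R\in T/_{\simeq}(R)$ iff some $s\in R$ is $\simeq$-divergent. $\simeq$ is label-preserving if $s\simeq t$ implies $\langle\!\langle s\rangle\!\rangle=\langle\!\langle t\rangle\!\rangle$. A label-preserving $\simeq$ is a stutter-insensitive bisimulation if for all $s,s',t\in S$ with $s\simeq t$ and $s\not\simeq s'\in T(s)$ there is a finite trajectory $t_0,\dots,t_k$ with $t_0=t$, $t_i\simeq s$ for $i=1,\dots,k-1$, and $t_k\simeq s'$. -}

module Defs where

open import Data.Nat using (ℕ; zero; suc; _<_; _≤_)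
open import Data.Bool using (Bool)
open import Data.Fin using (Fin)
open import Data.Product using (Σ; ∃; _×_; _,_)
open import Data.Sum using (_⊎_)
open import Relation.Nullary using (¬_)
open import Relation.Binary.PropositionalEquality using (_≡_; _≢_)
open import Relation.Binary.Structures using (IsEquivalence)

-- A label is a subset of AP, represented by its characteristic function AP → Bool;
-- equality of labels is extensional (pointwise) equality of these subsets.
record DLTS : Set₁ where
  field
    S   : Set
    I   : S → Set          -- initial region (not used by the theorem)
    T   : S → S            -- deterministic transition function: T(s) = {T s}
    AP  : Set
    lab : S → AP → Bool

module _ (M : DLTS) where
  open DLTS M

  Succ : S → S → Set
  Succ s s' = s' ≡ T s

  SameLabel : S → S → Set
  SameLabel s t = ∀ a → lab s a ≡ lab t a

  LabelPreservingClassifier : {C : Set} → (S → C) → Set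
  LabelPreservingClassifier f = ∀ s t → f s ≡ f t → SameLabel s t

  LabelPreserving : (S → S → Set) → Set
  LabelPreserving _≃_ = ∀ s t → s ≃ t → SameLabel s t

  Divergent : (S → S → Set) → S → Set
  Divergent _≃_ s = Σ (ℕ → S) λ σ →
    (σ 0 ≡ s) × (∀ i → Succ (σ i) (σ (suc i))) × (∀ i → σ (suc i) ≃ s)

  StutterBisim : (S → S → Set) → Set
  StutterBisim _≃_ =
    IsEquivalence _≃_ × LabelPreserving _≃_ ×
    (∀ s s' t → s ≃ t → ¬ (s ≃ s') → Succ s s' →
      Σ ℕ λ k → Σ (ℕ → S) λ τ →
        (τ 0 ≡ t) × (∀ i → i < k → Succ (τ i) (τ (suc i))) ×
        (∀ i → 1 ≤ i → i < k → τ i ≃ s) × (τ k ≃ s'))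

  -- Equivalence classes are represented as predicates on S, compared extensionally.
  _≐_ : (S → Set) → (S → Set) → Set
  R ≐ Q = ∀ t → (R t → Q t) × (Q t → R t)

  IsClass : (S → S → Set) → (S → Set) → Set
  IsClass _≃_ R = Σ S λ s → ∀ t → (R t → t ≃ s) × (t ≃ s → R t)

  -- Q ∈ T/≃ (R)   (R, Q classes of ≃)
  QStep : (S → S → Set) → (S → Set) → (S → Set) → Set
  QStep _≃_ R Q =
    (¬ (R ≐ Q) × Σ S λ s → R s × Q (T s)) ⊎
    ((R ≐ Q) × Σ S λ s → R s × Divergent _≃_ s)

_≃[_]_ : {S C : Set} → S → (S → C) → S → Set
s ≃[ f ] t = f s ≡ f t

preimage : {S C : Set} → (S → C) → C → S → Set
preimage f c s = f s ≡ c

{-# OPTIONS --safe #-}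
module Submission where

-- By (2), the successor of a state of class c lies in class c or g c. If g c ≢ c, then by (1)
-- the rank h c strictly decreases as long as a trajectory stays in class c, so by
-- well-foundedness it reaches class g c after finitely many steps, and no state of class c is
-- divergent. If g c ≡ c, class c is closed under T, so each of its states is divergent.

open import Defs
open import Data.Empty using (⊥)
open import Data.Fin using (Fin)
import Data.Fin.Properties as Fin
open import Data.Nat using (ℕ; zero; suc; _<_; _>_; _≤_; s≤s⁻¹)
open import Data.Nat.GeneralisedArithmetic using (iterate)
open import Data.Nat.Induction using (<-wellFounded)
open import Data.Nat.Properties using (≤-refl)
open import Data.Product using (Σ; _×_; _,_; proj₁; proj₂)
open import Data.Sum using (_⊎_; inj₁; inj₂)
open import Function using (_∘_)
open import Induction.InfiniteDescent using (InfiniteDescendingSequence)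
open import Induction.WellFounded using (WellFounded; Acc; acc)
open import Relation.Binary.Core using (Rel)
open import Relation.Binary.Definitions using (DecidableEquality)
open import Relation.Binary.PropositionalEquality
  using (_≡_; _≢_; refl; sym; trans; cong; subst; isEquivalence)
open import Relation.Nullary using (¬_; yes; no; contradiction)
import Relation.Binary.Construct.On as On

no-infinite-descent : ∀ {a r} {A : Set a} {_≺_ : Rel A r} → WellFounded _≺_ →
  (x : ℕ → A) → ¬ InfiniteDescendingSequence _≺_ x
no-infinite-descent {_≺_ = _≺_} wf x descends = go 0 (wf (x 0))
  where
  go : ∀ i → Acc _≺_ (x i) → ⊥
  go i (acc rs) = go (suc i) (rs (descends i))

iterate-suc : ∀ {a} {A : Set a} (f : A → A) x n → iterate f x (suc n) ≡ f (iterate f x n)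
iterate-suc f x zero    = refl
iterate-suc f x (suc n) = iterate-suc f (f x) n

module _ (M : DLTS) where
  open DLTS M

  ≐-sym : ∀ {R Q : S → Set} → _≐_ M R Q → _≐_ M Q R
  ≐-sym R≐Q t = proj₂ (R≐Q t) , proj₁ (R≐Q t)

  module _ {C : Set} (f : S → C) where

    preimage-isClass : ∀ {c} → Σ S (preimage f c) → IsClass M _≃[ f ]_ (preimage f c)
    preimage-isClass (s , fs) = s , λ t → (λ ft → trans ft (sym fs)) , (λ ft≡fs → trans ft≡fs fs)

    class≐preimage : ∀ {Q t c} → IsClass M _≃[ f ]_ Q → Q t → f t ≡ c → _≐_ M Q (preimage f c)
    class≐preimage {t = t} (_ , Q≐[q]) Qt ft≡c u =
      (λ Qu → trans (proj₁ (Q≐[q] u) Qu) (trans (sym (proj₁ (Q≐[q] t) Qt)) ft≡c)) ,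
      (λ fu≡c → proj₂ (Q≐[q] u) (trans fu≡c (trans (sym ft≡c) (proj₁ (Q≐[q] t) Qt))))

    RankedProgress : (g : C → C) (h : C → S → ℕ) → Set
    RankedProgress g h = ∀ c d s → c ≢ d → f s ≡ c → g c ≡ d →
      (f (T s) ≡ d) ⊎ ((f (T s) ≡ c) × (h c s > h c (T s)))

    ChangesFollow : (g : C → C) → Set
    ChangesFollow g = ∀ c d s → c ≢ d → f s ≡ c → f (T s) ≡ d → g c ≡ d

    module _ (_≟_ : DecidableEquality C) (g : C → C) (follow : ChangesFollow g) where

      successor-class : ∀ s → f (T s) ≡ f s ⊎ f (T s) ≡ g (f s)
      successor-class s with f (T s) ≟ f s
      ... | yes same   = inj₁ same
      ... | no changes = inj₂ (sym (follow (f s) (f (T s)) s (changes ∘ sym) refl refl))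

      fixed-class-closed : ∀ {c s} → g c ≡ c → f s ≡ c → f (T s) ≡ c
      fixed-class-closed {s = s} gc≡c fs with successor-class s
      ... | inj₁ same = trans same fs
      ... | inj₂ next = trans next (trans (cong g fs) gc≡c)

      fixed-class-invariant : ∀ {c s} → g c ≡ c → f s ≡ c → ∀ i → f (iterate T s i) ≡ c
      fixed-class-invariant gc≡c fs zero    = fs
      fixed-class-invariant gc≡c fs (suc i) = fixed-class-invariant gc≡c (fixed-class-closed gc≡c fs) i

      fixed-class-divergent : ∀ {c s} → g c ≡ c → f s ≡ c → Divergent M _≃[ f ]_ s
      fixed-class-divergent {s = s} gc≡c fs =
        iterate T s , refl , iterate-suc T s , λ i → trans (fixed-class-invariant gc≡c fs (suc i)) (sym fs)

      module RankedClassifier (h : C → S → ℕ) (progress : RankedProgress g h) where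

        rank-decreases : ∀ {c s s'} → g c ≢ c → Succ M s s' → f s ≡ c → f s' ≡ c → h c s' < h c s
        rank-decreases {c} {s} gc≢c refl fs fs' with progress c (g c) s (gc≢c ∘ sym) fs refl
        ... | inj₁ leaves         = contradiction (trans (sym leaves) fs') gc≢c
        ... | inj₂ (_ , decreases) = decreases

        not-divergent : ∀ {c s} → g c ≢ c → f s ≡ c → ¬ Divergent M _≃[ f ]_ s
        not-divergent {c} gc≢c fs (σ , σ0≡s , steps , stays) =
          no-infinite-descent <-wellFounded (h c ∘ σ) descends
          where
          inside : ∀ i → f (σ i) ≡ c
          inside zero    = trans (cong f σ0≡s) fs
          inside (suc i) = trans (stays i) fs

          descends : InfiniteDescendingSequence _<_ (h c ∘ σ)
          descends i = rank-decreases gc≢c (steps i) (inside i) (inside (suc i))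

        exits : ∀ {c t} → g c ≢ c → f t ≡ c → Acc _<_ (h c t) →
          Σ ℕ λ k → (∀ i → i ≤ k → f (iterate T t i) ≡ c) × f (iterate T t (suc k)) ≡ g c
        exits {c} {t} gc≢c ft (acc rs) with progress c (g c) t (gc≢c ∘ sym) ft refl
        ... | inj₁ leaves = 0 , (λ { zero _ → ft }) , leaves
        ... | inj₂ (stays , decreases) with exits gc≢c stays (rs decreases)
        ...   | k , inside , leaves =
                suc k , (λ { zero _ → ft ; (suc i) i≤k → inside i (s≤s⁻¹ i≤k) }) , leaves

        exit-edge : ∀ {c s} → g c ≢ c → f s ≡ c → Σ S λ u → f u ≡ c × f (T u) ≡ g c
        exit-edge {s = s} gc≢c fs =
          let k , inside , leaves = exits gc≢c fs (<-wellFounded _)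
          in  iterate T s k , inside k ≤-refl , subst (λ u → f u ≡ _) (iterate-suc T s k) leaves

        stutter-bisimulation : LabelPreservingClassifier M f → StutterBisim M _≃[ f ]_
        stutter-bisimulation preserves = On.isEquivalence f isEquivalence , preserves , catch-up
          where
          catch-up : ∀ s s' t → f s ≡ f t → f s ≢ f s' → Succ M s s' →
            Σ ℕ λ k → Σ (ℕ → S) λ τ →
              (τ 0 ≡ t) × (∀ i → i < k → Succ M (τ i) (τ (suc i))) ×
              (∀ i → 1 ≤ i → i < k → f (τ i) ≡ f s) × (f (τ k) ≡ f s')
          catch-up s _ t fs≡ft changes refl with successor-class s
          ... | inj₁ same = contradiction (sym same) changes
          ... | inj₂ next =
            let k , inside , leaves =
                  exits (λ gfs≡fs → changes (sym (trans next gfs≡fs))) (sym fs≡ft) (<-wellFounded _)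
            in  suc k , iterate T t , refl , (λ i _ → iterate-suc T t i) ,
                (λ i _ i<1+k → inside i (s≤s⁻¹ i<1+k)) , trans leaves (sym next)

        quotient-step-sound : ∀ {c Q} → IsClass M _≃[ f ]_ Q →
          QStep M _≃[ f ]_ (preimage f c) Q → _≐_ M Q (preimage f (g c))
        quotient-step-sound Q-class (inj₁ (P≉Q , s , fs , Q[Ts])) with successor-class s
        ... | inj₁ same = contradiction (≐-sym (class≐preimage Q-class Q[Ts] (trans same fs))) P≉Q
        ... | inj₂ next = class≐preimage Q-class Q[Ts] (trans next (cong g fs))
        quotient-step-sound {c} Q-class (inj₂ (P≐Q , s , fs , divergent)) with g c ≟ c
        ... | yes gc≡c = subst (λ d → _≐_ M _ (preimage f d)) (sym gc≡c) (≐-sym P≐Q)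
        ... | no gc≢c  = contradiction divergent (not-divergent gc≢c fs)

        quotient-step-complete : ∀ {c Q} → Σ S (preimage f c) →
          _≐_ M Q (preimage f (g c)) → QStep M _≃[ f ]_ (preimage f c) Q
        quotient-step-complete {c} (s , fs) Q≐P with g c ≟ c
        ... | yes gc≡c =
          inj₂ (≐-sym (subst (λ d → _≐_ M _ (preimage f d)) gc≡c Q≐P) , s , fs , fixed-class-divergent gc≡c fs)
        ... | no gc≢c =
          let u , fu , fTu = exit-edge gc≢c fs
          in  inj₁ ((λ P≐Q → gc≢c (trans (sym (proj₁ (Q≐P s) (proj₁ (P≐Q s) fs))) fs)) ,
                    u , fu , proj₂ (Q≐P (T u)) fTu)

        successor-inhabited : ∀ {c} → Σ S (preimage f c) → Σ S (preimage f (g c))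
        successor-inhabited {c} (s , fs) with g c ≟ c
        ... | yes gc≡c = s , trans fs (sym gc≡c)
        ... | no gc≢c  = let u , _ , fTu = exit-edge gc≢c fs in T u , fTu

theorem3 : (M : DLTS) → (n : ℕ) →
    (f : DLTS.S M → Fin n) → (g : Fin n → Fin n) → (h : Fin n → DLTS.S M → ℕ) →
    LabelPreservingClassifier M f →
    (∀ (c d : Fin n) (s : DLTS.S M) → c ≢ d → f s ≡ c → g c ≡ d →
      (f (DLTS.T M s) ≡ d) ⊎ ((f (DLTS.T M s) ≡ c) × (h c s > h c (DLTS.T M s)))) →
    (∀ (c d : Fin n) (s : DLTS.S M) → c ≢ d → f s ≡ c → f (DLTS.T M s) ≡ d → g c ≡ d) →
    StutterBisim M (λ s t → s ≃[ f ] t) ×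
    (∀ (c : Fin n) → Σ (DLTS.S M) (λ s → preimage f c s) →
      IsClass M (λ s t → s ≃[ f ] t) (preimage f (g c)) ×
      (∀ (Q : DLTS.S M → Set) → IsClass M (λ s t → s ≃[ f ] t) Q →
        (QStep M (λ s t → s ≃[ f ] t) (preimage f c) Q → _≐_ M Q (preimage f (g c))) ×
        (_≐_ M Q (preimage f (g c)) → QStep M (λ s t → s ≃[ f ] t) (preimage f c) Q)))
theorem3 M n f g h preserves progress follow =
  stutter-bisimulation preserves ,
  λ c inhabited →
    preimage-isClass M f (successor-inhabited inhabited) ,
    λ Q Q-class → quotient-step-sound Q-class , quotient-step-complete inhabited
  where open RankedClassifier M f Fin._≟_ g follow h progress
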